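{- Let $n \geq 1$, let $g(y) = \sum_{\lambda \in \mathbb{N}^n} g_\lambda y^\lambda$ be a power series in $n$ variables, and let $f = g \circ \sigma = \sum_{\nu \in \mathbb{N}^n} f_\nu x^\nu$, so that for every nonzero $\nu \in \mathbb{N}^n$ the multivariate Faà di Bruno formula gives $$f_\nu = \sum_{\lambda \in \mathbb{N}^n,\ 1 \leq |\lambda| \leq |\nu|} g_\lambda\, C(\nu,\lambda).$$ Let $\nu \in \mathbb{N}^n$ be nonzero and $d = |\nu|$. Then in this equation the summation range $\{\lambda : 1 \leq |\lambda| \leq |\nu|\}$ can be replaced by $\{\lambda \in \mathbb{N}^n : \|\lambda\| = d\}$; that is, $$f_\nu = \sum_{\lambda \in \mathbb{N}^n,\ \|\lambda\| = d} g_\lambda\, C(\nu,\lambda).$$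
   Context: For $\nu \in \mathbb{N}^n$: degree $|\nu| = \sum_{i=1}^n \nu_i$, weight $\|\nu\| = \sum_{i=1}^n i\,\nu_i$, $x^\nu = \prod_i x_i^{\nu_i}$, $\nu! = \prod_i \nu_i!$ (with $0!=1$, $0^0=1$). The elementary symmetric polynomials are $\sigma^k(x) = \sum_{i_1<\cdots<i_k} x_{i_1}\cdots x_{i_k}$, $1 \le k \le n$, and $\sigma = (\sigma^1,\ldots,\sigma^n)$. Write $\sigma^i(x) = \sum_{\mu} \frac{\sigma^i_\mu}{\mu!} x^\mu$ (so $\sigma^i_\mu = 1$ if $\mu \in \{0,1\}^n$ with $|\mu| = i$, and $0$ otherwise), and $h_\mu = (\sigma^1_\mu, \ldots, \sigma^n_\mu)$; for $k \in \mathbb{N}^n$ put $(h_\mu)^k = \prod_{i=1}^n (\sigma^i_\mu)^{k_i}$. Order $\mathbb{N}^n$ by $\mu \prec \mu'$ iff $|\mu| < |\mu'|$, or $|\mu| = |\mu'|$ and $\mu$ precedes $\mu'$ lexicographically. For nonzero $\nu$ with $N = |\nu|$ and $\lambda \in \mathbb{N}^n$, let $p(\nu,\lambda)$ be the set of tuples $(k_1,\ldots,k_N; l_1,\ldots,l_N)$ of elements of $\mathbb{N}^n$ such that for some $1 \le s \le N$: $k_i = 0$ and $l_i = 0$ for $1 \le i \le N-s$; $|k_i| > 0$ for $N-s+1 \le i \le N$; $0 \prec l_{N-s+1} \prec \cdots \prec l_N$; $\sum_{i=1}^N k_i = \lambda$ and $\sum_{i=1}^N |k_i|\, l_i = \nu$.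 Define $$C(\nu,\lambda) = \lambda! \sum_{(k;l) \in p(\nu,\lambda)} \prod_{j=1}^N \frac{(h_{l_j})^{k_j}}{k_j!\,(l_j!)^{|k_j|}}.$$ (By the Faà di Bruno formula, $C(\nu,\lambda)$ equals the coefficient of $x^\nu$ in $\prod_{i=1}^n (\sigma^i(x))^{\lambda_i}$.)
   Formalization: The coefficients $g_\lambda$ of the power series g are rational rather than real. -}

module Defs where

open import Data.Bool using (Bool; true; false; _∧_; _∨_; if_then_else_; not)
open import Data.Nat as ℕ using (ℕ; zero; suc; _≡ᵇ_; _<ᵇ_; _≤ᵇ_; NonZero; _!)
open import Data.Nat.Properties using (_!≢0; m*n≢0; m^n≢0)
open import Data.Integer using (+_)
open import Data.List as List using (List; []; _∷_; upTo; concatMap; filterᵇ; foldr; take; drop; length; replicate)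
open import Data.Vec as Vec using (Vec; []; _∷_)
open import Data.Product using (_×_; _,_; proj₁; proj₂)
open import Data.Rational as ℚ using (ℚ; 0ℚ; 1ℚ)

MI : ℕ → Set
MI n = Vec ℕ n

deg : ∀ {n} → MI n → ℕ
deg = Vec.sum

-- weight ‖ν‖ = Σ i·νᵢ  (i counted from 1)
wtFrom : ∀ {n} → ℕ → MI n → ℕ
wtFrom o []       = 0
wtFrom o (x ∷ xs) = suc o ℕ.* x ℕ.+ wtFrom (suc o) xs

wt : ∀ {n} → MI n → ℕ
wt = wtFrom 0

mfact : ∀ {n} → MI n → ℕ
mfact []       = 1
mfact (x ∷ xs) = x ! ℕ.* mfact xs

mfact≢0 : ∀ {n} (ν : MI n) → NonZero (mfact ν)
mfact≢0 []       = _
mfact≢0 (x ∷ xs) = m*n≢0 (x !) (mfact xs) {{x !≢0}} {{mfact≢0 xs}}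

_==_ : ∀ {n} → MI n → MI n → Bool
[]       == []       = true
(x ∷ xs) == (y ∷ ys) = (x ≡ᵇ y) ∧ (xs == ys)

zeroMI : ∀ {n} → MI n
zeroMI {n} = Vec.replicate n 0

lexLt : ∀ {n} → MI n → MI n → Bool
lexLt []       []       = false
lexLt (x ∷ xs) (y ∷ ys) = (x <ᵇ y) ∨ ((x ≡ᵇ y) ∧ lexLt xs ys)

_≺_ : ∀ {n} → MI n → MI n → Bool
μ ≺ μ' = (deg μ <ᵇ deg μ') ∨ ((deg μ ≡ᵇ deg μ') ∧ lexLt μ μ')

isBinary : ∀ {n} → MI n → Bool
isBinary []       = true
isBinary (x ∷ xs) = (x ≤ᵇ 1) ∧ isBinary xs

sigmaCoeff : ∀ {n} → ℕ → MI n → ℕ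
sigmaCoeff i μ = if isBinary μ ∧ (deg μ ≡ᵇ i) then 1 else 0

-- (h_μ)^k = Π_{i=1}^n (σ^i_μ)^{kᵢ}
hPowFrom : ∀ {n m} → ℕ → MI n → Vec ℕ m → ℕ
hPowFrom o μ []       = 1
hPowFrom o μ (k ∷ ks) = sigmaCoeff (suc o) μ ℕ.^ k ℕ.* hPowFrom (suc o) μ ks

hPow : ∀ {n} → MI n → MI n → ℕ
hPow μ k = hPowFrom 0 μ k

_⊕_ : ∀ {n} → MI n → MI n → MI n
_⊕_ = Vec.zipWith ℕ._+_

_⊙_ : ∀ {n} → ℕ → MI n → MI n
c ⊙ v = Vec.map (c ℕ.*_) v

box : ∀ {n} → MI n → List (MI n)
box []       = [] ∷ []
box (b ∷ bs) = concatMap (λ x → List.map (x ∷_) (box bs)) (upTo (suc b))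

tuples : ∀ {A : Set} → ℕ → List A → List (List A)
tuples zero    L = [] ∷ []
tuples (suc N) L = concatMap (λ a → List.map (a ∷_) (tuples N L)) L

pairs : ∀ {A B : Set} → List A → List B → List (A × B)
pairs as bs = concatMap (λ a → List.map (a ,_) bs) as

allL : ∀ {A : Set} → (A → Bool) → List A → Bool
allL p []       = true
allL p (x ∷ xs) = p x ∧ allL p xs

anyL : ∀ {A : Set} → (A → Bool) → List A → Bool
anyL p []       = false
anyL p (x ∷ xs) = p x ∨ anyL p xs

chain : ∀ {n} → MI n → List (MI n) → Bool
chain prev []       = true
chain prev (l ∷ ls) = (prev ≺ l) ∧ chain l ls

sumMI : ∀ {n} → List (MI n) → MI n
sumMI = foldr _⊕_ zeroMI

-- membership of a tuple (k₁,…,k_N; l₁,…,l_N), given as the list of pairs (kᵢ,lᵢ),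
-- in p(ν,λ), with N = |ν|, for a given s
inPs : ∀ {n} → MI n → MI n → List (MI n × MI n) → ℕ → Bool
inPs ν lm t s =
  let N    = deg ν
      pre  = take (N ℕ.∸ s) t
      post = drop (N ℕ.∸ s) t
  in allL (λ p → (proj₁ p == zeroMI) ∧ (proj₂ p == zeroMI)) pre
   ∧ allL (λ p → 1 ≤ᵇ deg (proj₁ p)) post
   ∧ chain zeroMI (List.map proj₂ post)
   ∧ (sumMI (List.map proj₁ t) == lm)
   ∧ (sumMI (List.map (λ p → deg (proj₁ p) ⊙ proj₂ p) t) == ν)

inP : ∀ {n} → MI n → MI n → List (MI n × MI n) → Bool
inP ν lm t = (length t ≡ᵇ deg ν) ∧ anyL (λ s → inPs ν lm t s) (List.map suc (upTo (deg ν)))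

-- A finite list containing every element of p(ν,λ) exactly once:
-- every kᵢ ≤ λ and every lᵢ ≤ ν componentwise (lᵢ = 0 when kᵢ = 0, and
-- |kᵢ| lᵢ ≤ ν otherwise), filtered by membership in p(ν,λ).
pSet : ∀ {n} → MI n → MI n → List (List (MI n × MI n))
pSet ν lm = filterᵇ (inP ν lm) (tuples (deg ν) (pairs (box lm) (box ν)))

sumℚ : List ℚ → ℚ
sumℚ = foldr ℚ._+_ 0ℚ

productℚ : List ℚ → ℚ
productℚ = foldr ℚ._*_ 1ℚ

factor : ∀ {n} → MI n × MI n → ℚ
factor (k , l) =
  ((+ hPow l k) ℚ./ (mfact k ℕ.* mfact l ℕ.^ deg k))
    {{m*n≢0 (mfact k) (mfact l ℕ.^ deg k) {{mfact≢0 k}} {{m^n≢0 (mfact l) (deg k) {{mfact≢0 l}}}}}}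

C : ∀ {n} → MI n → MI n → ℚ
C ν lm = ((+ mfact lm) ℚ./ 1) ℚ.* sumℚ (List.map (λ t → productℚ (List.map factor t)) (pSet ν lm))

-- candidate λ's: all λ with every entry ≤ |ν| (contains both summation ranges)
candidates : ∀ {n} → MI n → List (MI n)
candidates {n} ν = box (Vec.replicate n (deg ν))

fCoeff : ∀ {n} → (MI n → ℚ) → MI n → ℚ
fCoeff g ν = sumℚ (List.map (λ lm → g lm ℚ.* C ν lm)
                   (filterᵇ (λ lm → (1 ≤ᵇ deg lm) ∧ (deg lm ≤ᵇ deg ν)) (candidates ν)))

weightSum : ∀ {n} → (MI n → ℚ) → MI n → ℕ → ℚ
weightSum g ν d = sumℚ (List.map (λ lm → g lm ℚ.* C ν lm)
                   (filterᵇ (λ lm → wt lm ≡ᵇ d) (candidates ν)))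

-- A tuple (k;l) contributes to C(ν,λ) only if every factor (h_{l_j})^{k_j} is nonzero, i.e. only
-- if |l_j| = i whenever the i-th entry of k_j is positive; then |k_j| |l_j| = ‖k_j‖. Summing
-- over j, |ν| = Σ |k_j| |l_j| = Σ ‖k_j‖ = ‖λ‖. Hence C(ν,λ) = 0 unless ‖λ‖ = |ν|, and
-- ‖λ‖ = |ν| ≥ 1 already forces 1 ≤ |λ| ≤ ‖λ‖ = |ν|.
module Submission where

open import Defs
open import Data.Nat using (ℕ; _≤_)
open import Data.Rational using (ℚ)
open import Relation.Binary.PropositionalEquality using (_≡_; _≢_)

open import Algebra.Properties.CommutativeSemigroup using (interchange)
open import Data.Bool using (Bool; true; false; _∧_; T)
open import Data.Bool.Properties using (T-∧; T-∨; T-≡)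
open import Data.Empty using (⊥-elim)
open import Data.Integer using () renaming (+_ to ℤ+_)
open import Data.List as List using (List; []; _∷_; filterᵇ)
open import Data.List.Relation.Unary.All using (All; []; _∷_)
open import Data.Nat as ℕ using (zero; suc; _+_; _*_; _^_; NonZero; _≡ᵇ_; _≤ᵇ_; z≤n; s≤s)
open import Data.Nat.Properties as ℕ
  using (≡ᵇ⇒≡; ≡⇒≡ᵇ; ≤⇒≤ᵇ; m+n≡0⇒m≡0; m+n≡0⇒n≡0; m≤m+n; +-mono-≤; *-comm; *-zeroʳ;
         *-distribˡ-+; ≤-trans; ≤-reflexive; _≟_)
open import Data.Product using (_×_; _,_; proj₁; proj₂; Σ-syntax)
open import Data.Rational as ℚ using (0ℚ)
open import Data.Rational.Properties as ℚ using (0/n≡0)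
open import Data.Sum using (_⊎_; inj₁; inj₂)
open import Data.Vec using (Vec; []; _∷_)
open import Function using (_∘_)
open import Function.Bundles using (Equivalence)
open import Relation.Binary.PropositionalEquality using (refl; sym; trans; cong; cong₂; subst; module ≡-Reasoning)
open import Relation.Nullary using (¬_; yes; no)

open Equivalence using (to; from)

T-∧ʳ : ∀ {x y} → T (x ∧ y) → T y
T-∧ʳ = proj₂ ∘ to T-∧

anyL-witness : ∀ {A : Set} (p : A → Bool) (xs : List A) → T (anyL p xs) → Σ[ x ∈ A ] T (p x)
anyL-witness p (x ∷ xs) h with to (T-∨ {p x}) h
... | inj₁ px = x , px
... | inj₂ rest = anyL-witness p xs rest

==⇒≡ : ∀ {n} (a b : MI n) → T (a == b) → a ≡ b
==⇒≡ []       []       _ = refl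
==⇒≡ (x ∷ xs) (y ∷ ys) h with to T-∧ h
... | x≡y , xs≡ys = cong₂ _∷_ (≡ᵇ⇒≡ x y x≡y) (==⇒≡ xs ys xs≡ys)

+-interchange : ∀ a b c d → (a + b) + (c + d) ≡ (a + c) + (b + d)
+-interchange = interchange ℕ.+-commutativeSemigroup

deg-⊕ : ∀ {n} (a b : MI n) → deg (a ⊕ b) ≡ deg a + deg b
deg-⊕ []       []       = refl
deg-⊕ (x ∷ xs) (y ∷ ys) =
  trans (cong (x + y +_) (deg-⊕ xs ys)) (+-interchange x y (deg xs) (deg ys))

wtFrom-⊕ : ∀ {n} o (a b : MI n) → wtFrom o (a ⊕ b) ≡ wtFrom o a + wtFrom o b
wtFrom-⊕ o []       []       = refl
wtFrom-⊕ o (x ∷ xs) (y ∷ ys) = begin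
  suc o * (x + y) + wtFrom (suc o) (xs ⊕ ys)
    ≡⟨ cong₂ _+_ (*-distribˡ-+ (suc o) x y) (wtFrom-⊕ (suc o) xs ys) ⟩
  (suc o * x + suc o * y) + (wtFrom (suc o) xs + wtFrom (suc o) ys)
    ≡⟨ +-interchange (suc o * x) (suc o * y) _ _ ⟩
  (suc o * x + wtFrom (suc o) xs) + (suc o * y + wtFrom (suc o) ys) ∎
  where open ≡-Reasoning

deg-⊙ : ∀ {n} c (v : MI n) → deg (c ⊙ v) ≡ c * deg v
deg-⊙ c []       = sym (*-zeroʳ c)
deg-⊙ c (x ∷ xs) = trans (cong (c * x +_) (deg-⊙ c xs)) (sym (*-distribˡ-+ c x (deg xs)))

deg-zeroMI : ∀ n → deg (zeroMI {n}) ≡ 0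
deg-zeroMI zero    = refl
deg-zeroMI (suc n) = deg-zeroMI n

deg≡0⇒wtFrom≡0 : ∀ {n} o (v : MI n) → deg v ≡ 0 → wtFrom o v ≡ 0
deg≡0⇒wtFrom≡0 o []       _ = refl
deg≡0⇒wtFrom≡0 o (x ∷ xs) h with m+n≡0⇒m≡0 x h
... | refl = trans (cong (_+ wtFrom (suc o) xs) (*-zeroʳ (suc o)))
                   (deg≡0⇒wtFrom≡0 (suc o) xs (m+n≡0⇒n≡0 x h))

deg≤wtFrom : ∀ {n} o (v : MI n) → deg v ≤ wtFrom o v
deg≤wtFrom o []       = z≤n
deg≤wtFrom o (x ∷ xs) = +-mono-≤ (m≤m+n x (o * x)) (deg≤wtFrom (suc o) xs)

wt≡d≢0⇒1≤deg≤d : ∀ {n} (v : MI n) {d} → d ≢ 0 → wt v ≡ d → 1 ≤ deg v × deg v ≤ d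
wt≡d≢0⇒1≤deg≤d v d≢0 wt≡d with deg v in deg≡
... | zero  = ⊥-elim (d≢0 (trans (sym wt≡d) (deg≡0⇒wtFrom≡0 0 v deg≡)))
... | suc _ = s≤s z≤n , ≤-trans (subst (_≤ wt v) deg≡ (deg≤wtFrom 0 v)) (≤-reflexive wt≡d)

sigmaCoeff≢0⇒deg≡ : ∀ {n} i (l : MI n) → sigmaCoeff i l ≢ 0 → deg l ≡ i
sigmaCoeff≢0⇒deg≡ i l ≢0 with isBinary l ∧ (deg l ≡ᵇ i) in eq
... | false = ⊥-elim (≢0 refl)
... | true  = ≡ᵇ⇒≡ (deg l) i (T-∧ʳ {isBinary l} (from T-≡ eq))

*≢0⇒≢0 : ∀ a b → a * b ≢ 0 → a ≢ 0 × b ≢ 0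
*≢0⇒≢0 a b ≢0 = (λ a≡0 → ≢0 (cong (_* b) a≡0)) , (λ b≡0 → ≢0 (trans (cong (a *_) b≡0) (*-zeroʳ a)))

hPowFrom≢0⇒deg*deg≡wtFrom : ∀ {n m} o (l : MI n) (k : Vec ℕ m) →
  hPowFrom o l k ≢ 0 → deg l * deg k ≡ wtFrom o k
hPowFrom≢0⇒deg*deg≡wtFrom o l []            _  = *-zeroʳ (deg l)
hPowFrom≢0⇒deg*deg≡wtFrom o l (zero ∷ ks)   ≢0 =
  trans (hPowFrom≢0⇒deg*deg≡wtFrom (suc o) l ks (proj₂ (*≢0⇒≢0 1 _ ≢0)))
        (cong (_+ wtFrom (suc o) ks) (sym (*-zeroʳ (suc o))))
hPowFrom≢0⇒deg*deg≡wtFrom o l (suc x ∷ ks) ≢0 =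
  trans (*-distribˡ-+ (deg l) (suc x) (deg ks))
        (cong₂ _+_ (cong (_* suc x) deg-l≡) (hPowFrom≢0⇒deg*deg≡wtFrom (suc o) l ks ks≢0))
  where
  s : ℕ
  s = sigmaCoeff (suc o) l
  pow≢0×ks≢0 : s ^ suc x ≢ 0 × hPowFrom (suc o) l ks ≢ 0
  pow≢0×ks≢0 = *≢0⇒≢0 (s ^ suc x) _ ≢0
  ks≢0 : hPowFrom (suc o) l ks ≢ 0
  ks≢0 = proj₂ pow≢0×ks≢0
  deg-l≡ : deg l ≡ suc o
  deg-l≡ = sigmaCoeff≢0⇒deg≡ (suc o) l (proj₁ (*≢0⇒≢0 s _ (proj₁ pow≢0×ks≢0)))

Tuple : ℕ → Set
Tuple n = List (MI n × MI n)

tupleλ : ∀ {n} → Tuple n → MI n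
tupleλ t = sumMI (List.map proj₁ t)

tupleν : ∀ {n} → Tuple n → MI n
tupleν t = sumMI (List.map (λ p → deg (proj₁ p) ⊙ proj₂ p) t)

NonVanishing : ∀ {n} → MI n × MI n → Set
NonVanishing (k , l) = hPow l k ≢ 0

deg-tupleν≡wt-tupleλ : ∀ {n} (t : Tuple n) → All NonVanishing t → deg (tupleν t) ≡ wt (tupleλ t)
deg-tupleν≡wt-tupleλ {n} [] [] = trans (deg-zeroMI n) (sym (deg≡0⇒wtFrom≡0 0 (zeroMI {n}) (deg-zeroMI n)))
deg-tupleν≡wt-tupleλ ((k , l) ∷ t) (≢0 ∷ nv) = begin
  deg ((deg k ⊙ l) ⊕ tupleν t)       ≡⟨ deg-⊕ (deg k ⊙ l) (tupleν t) ⟩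
  deg (deg k ⊙ l) + deg (tupleν t)    ≡⟨ cong₂ _+_ (deg-⊙ (deg k) l) (deg-tupleν≡wt-tupleλ t nv) ⟩
  deg k * deg l + wt (tupleλ t)       ≡⟨ cong (_+ wt (tupleλ t)) (*-comm (deg k) (deg l)) ⟩
  deg l * deg k + wt (tupleλ t)       ≡⟨ cong (_+ wt (tupleλ t)) (hPowFrom≢0⇒deg*deg≡wtFrom 0 l k ≢0) ⟩
  wt k + wt (tupleλ t)                ≡⟨ sym (wtFrom-⊕ 0 k (tupleλ t)) ⟩
  wt (k ⊕ tupleλ t)                   ∎
  where open ≡-Reasoning

T-∧-last₂ : ∀ a b c {d e} → T (a ∧ b ∧ c ∧ d ∧ e) → T d × T e
T-∧-last₂ true true true = to T-∧

inPs⇒tupleλ≡×tupleν≡ : ∀ {n} (ν lm : MI n) (t : Tuple n) s → T (inPs ν lm t s) → tupleλ t ≡ lm × tupleν t ≡ ν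
inPs⇒tupleλ≡×tupleν≡ {n} ν lm t s h =
  let λ≡ , ν≡ = T-∧-last₂ zeroPrefix positiveSuffix increasingL h
  in ==⇒≡ (tupleλ t) lm λ≡ , ==⇒≡ (tupleν t) ν ν≡
  where
  post : Tuple n
  post = List.drop (deg ν ℕ.∸ s) t
  zeroPrefix positiveSuffix increasingL : Bool
  zeroPrefix = allL (λ p → (proj₁ p == zeroMI) ∧ (proj₂ p == zeroMI)) (List.take (deg ν ℕ.∸ s) t)
  positiveSuffix = allL (λ p → 1 ≤ᵇ deg (proj₁ p)) post
  increasingL = chain zeroMI (List.map proj₂ post)

inP⇒tupleλ≡×tupleν≡ : ∀ {n} (ν lm : MI n) (t : Tuple n) → T (inP ν lm t) → tupleλ t ≡ lm × tupleν t ≡ ν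
inP⇒tupleλ≡×tupleν≡ ν lm t h
  with anyL-witness (inPs ν lm t) (List.map suc (List.upTo (deg ν))) (T-∧ʳ {List.length t ≡ᵇ deg ν} h)
... | s , inPs-s = inPs⇒tupleλ≡×tupleν≡ ν lm t s inPs-s

a≡0⇒a/d≡0 : ∀ a d .{{_ : NonZero d}} → a ≡ 0 → (ℤ+ a) ℚ./ d ≡ 0ℚ
a≡0⇒a/d≡0 .0 d refl = 0/n≡0 d

factor≡0 : ∀ {n} (k l : MI n) → hPow l k ≡ 0 → factor (k , l) ≡ 0ℚ
factor≡0 k l = a≡0⇒a/d≡0 (hPow l k) (mfact k * mfact l ^ deg k)
  {{ℕ.m*n≢0 (mfact k) _ {{mfact≢0 k}} {{ℕ.m^n≢0 (mfact l) (deg k) {{mfact≢0 l}}}}}}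

productℚ-factor≡0⊎All-NonVanishing : ∀ {n} (t : Tuple n) →
  productℚ (List.map factor t) ≡ 0ℚ ⊎ All NonVanishing t
productℚ-factor≡0⊎All-NonVanishing [] = inj₂ []
productℚ-factor≡0⊎All-NonVanishing ((k , l) ∷ t) with hPow l k ≟ 0
... | yes ≡0 = inj₁ (trans (cong (ℚ._* rest) (factor≡0 k l ≡0)) (ℚ.*-zeroˡ rest))
  where
  rest : ℚ
  rest = productℚ (List.map factor t)
... | no ≢0 with productℚ-factor≡0⊎All-NonVanishing t
...   | inj₁ ≡0 = inj₁ (trans (cong (factor (k , l) ℚ.*_) ≡0) (ℚ.*-zeroʳ (factor (k , l))))
...   | inj₂ nv = inj₂ (≢0 ∷ nv)

sumℚ-filter≡0 : ∀ {A : Set} (p : A → Bool) (F : A → ℚ) (xs : List A) →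
  (∀ x → T (p x) → F x ≡ 0ℚ) → sumℚ (List.map F (filterᵇ p xs)) ≡ 0ℚ
sumℚ-filter≡0 p F []       _  = refl
sumℚ-filter≡0 p F (x ∷ xs) F≡0 with p x in px
... | false = sumℚ-filter≡0 p F xs F≡0
... | true  = trans (cong₂ ℚ._+_ (F≡0 x (from T-≡ px)) (sumℚ-filter≡0 p F xs F≡0)) (ℚ.+-identityˡ 0ℚ)

wt≢deg⇒C≡0 : ∀ {n} (ν lm : MI n) → wt lm ≢ deg ν → C ν lm ≡ 0ℚ
wt≢deg⇒C≡0 ν lm wt≢deg =
  trans (cong (lm! ℚ.*_) (sumℚ-filter≡0 (inP ν lm) _ (tuples (deg ν) (pairs (box lm) (box ν))) term≡0))
        (ℚ.*-zeroʳ lm!)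
  where
  lm! : ℚ
  lm! = (ℤ+ mfact lm) ℚ./ 1
  term≡0 : ∀ t → T (inP ν lm t) → productℚ (List.map factor t) ≡ 0ℚ
  term≡0 t t∈p with productℚ-factor≡0⊎All-NonVanishing t
  ... | inj₁ ≡0 = ≡0
  ... | inj₂ nv with inP⇒tupleλ≡×tupleν≡ ν lm t t∈p
  ...   | refl , refl = ⊥-elim (wt≢deg (sym (deg-tupleν≡wt-tupleλ t nv)))

sumℚ-filter-shrink : ∀ {A : Set} (p q : A → Bool) (F : A → ℚ) (xs : List A) →
  (∀ x → T (q x) → T (p x)) → (∀ x → ¬ T (q x) → F x ≡ 0ℚ) →
  sumℚ (List.map F (filterᵇ p xs)) ≡ sumℚ (List.map F (filterᵇ q xs))
sumℚ-filter-shrink p q F []       _   _   = refl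
sumℚ-filter-shrink p q F (x ∷ xs) q⇒p F≡0 with p x in px | q x in qx
... | true  | true  = cong (F x ℚ.+_) (sumℚ-filter-shrink p q F xs q⇒p F≡0)
... | true  | false =
  trans (cong₂ ℚ._+_ (F≡0 x (subst T qx)) (sumℚ-filter-shrink p q F xs q⇒p F≡0)) (ℚ.+-identityˡ _)
... | false | true  = ⊥-elim (subst T px (q⇒p x (from T-≡ qx)))
... | false | false = sumℚ-filter-shrink p q F xs q⇒p F≡0

mainTheorem2 : (n : ℕ) → 1 ≤ n → (g : MI n → ℚ) → (ν : MI n) → deg ν ≢ 0 →
    fCoeff g ν ≡ weightSum g ν (deg ν)
mainTheorem2 n _ g ν deg≢0 = sumℚ-filter-shrink _ _ _ (candidates ν) weight⇒degreeRange offWeight≡0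
  where
  weight⇒degreeRange : ∀ lm → T (wt lm ≡ᵇ deg ν) → T ((1 ≤ᵇ deg lm) ∧ (deg lm ≤ᵇ deg ν))
  weight⇒degreeRange lm wt≡ with wt≡d≢0⇒1≤deg≤d lm deg≢0 (≡ᵇ⇒≡ _ _ wt≡)
  ... | 1≤deg , deg≤ = from T-∧ (≤⇒≤ᵇ 1≤deg , ≤⇒≤ᵇ deg≤)
  offWeight≡0 : ∀ lm → ¬ T (wt lm ≡ᵇ deg ν) → g lm ℚ.* C ν lm ≡ 0ℚ
  offWeight≡0 lm wt≢ = trans (cong (g lm ℚ.*_) (wt≢deg⇒C≡0 ν lm (wt≢ ∘ ≡⇒≡ᵇ _ _))) (ℚ.*-zeroʳ (g lm))
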